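{- Let $p,q$ be primes with $2<p<q$. If $\kappa+\lambda\le p-\lambda$, then every integer greater than $g_1$ is representable.
   Context: Let $p,q$ be primes with $2<p<q$, and put $p'=(p-1)/2$, $q'=(q-1)/2$. Set $d_0=pq$, $d_1=p'q$, $d_2=pq'$, $d_3=(pq-1)/2$, and for integers $x,y,z,w$ put $f(x,y,z,w)=xd_0+yd_1+zd_2+wd_3$. An integer is representable if it equals $f(x,y,z,w)$ for some nonnegative integers $x,y,z,w$. Define $\kappa,\lambda$ by $q=\kappa p+\lambda$ with $1\le\lambda\le p-1$, and put $g_0=f(p'-1,p-1,\kappa,-1)$ and $g_1=g_0-\lambda d_3$. -}

module Defs where

open import Data.Nat using (ℕ; _∸_; _*_)
open import Data.Nat.DivMod using (_/_)
open import Data.Integer as ℤ using (ℤ; +_)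
open import Data.Product using (∃; Σ; _,_)
open import Relation.Binary.PropositionalEquality using (_≡_)

-- p' = (p-1)/2, q' = (q-1)/2 (exact for odd primes)
half : ℕ → ℕ
half n = (n ∸ 1) / 2

d₀ d₁ d₂ d₃ : ℕ → ℕ → ℕ
d₀ p q = p * q
d₁ p q = half p * q
d₂ p q = p * half q
d₃ p q = half (p * q)

f : ℕ → ℕ → ℤ → ℤ → ℤ → ℤ → ℤ
f p q x y z w =
  x ℤ.* + d₀ p q ℤ.+ y ℤ.* + d₁ p q ℤ.+ z ℤ.* + d₂ p q ℤ.+ w ℤ.* + d₃ p q

Representable : ℕ → ℕ → ℤ → Set
Representable p q n =
  Σ ℕ λ x → Σ ℕ λ y → Σ ℕ λ z → Σ ℕ λ w → n ≡ f p q (+ x) (+ y) (+ z) (+ w)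

g₀ : ℕ → ℕ → ℕ → ℤ
g₀ p q κ = f p q (+ half p ℤ.- + 1) (+ p ℤ.- + 1) (+ κ) (ℤ.- + 1)

g₁ : ℕ → ℕ → ℕ → ℕ → ℤ
g₁ p q κ λ′ = g₀ p q κ ℤ.- + λ′ ℤ.* + d₃ p q

-- For odd p and q, 2 f(x,y,z,w) = (2x+y+z+w)pq − (yq+zp+w).  Hence n is representable as soon
-- as 2n + t = s·pq with t = yq + zp + w of cost c = y+z+w ≤ s and c ≡ s (mod 2).  Let s·pq be
-- the least multiple of pq that is ≥ 2n and write the defect t < pq greedily as t = uq + ap + b,
-- borrowing one q when the last digit b is large.  Under κ + 2λ ≤ p this costs at most
-- 2p + κ − 3 − λ, and one less when t ≤ pq − 2λ − 2; on the other side n > g₁ gives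
-- s ≥ 2p + κ − 5 − λ, and one more when t > pq − 2λ − 2.  So c ≤ s + 1, and c ≠ s + 1 because
-- p, q and pq are odd, which makes c ≡ t ≡ s (mod 2).
module Submission where

open import Defs
open import Data.Nat
  using (ℕ; zero; suc; _+_; _*_; _∸_; _≤_; _<_; _≤?_; _<?_; s≤s; z≤n; NonZero; >-nonZero; >-nonZero⁻¹)
open import Data.Nat.Properties
open import Data.Nat.DivMod using (_/_; _%_; m%n<n; m≡m%n+[m/n]*n; m*n/n≡m)
open import Data.Nat.Divisibility using (_∣_; divides; ∣m+n∣m⇒∣n; ∣1⇒≡1; m∣m*n)
open import Data.Nat.Primality using (Prime; composite; prime⇒¬composite)
open import Data.Nat.Tactic.RingSolver using (solve; solve-∀)
open import Data.Integer as ℤ using (ℤ; -[1+_])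
import Data.Integer.Properties as ℤ
import Data.Integer.Tactic.RingSolver as ℤ-Solver
open import Data.List using (_∷_; [])
open import Data.Product using (∃; Σ; _×_; _,_)
open import Data.Sum using (_⊎_; inj₁; inj₂)
open import Function using (_∘_)
open import Relation.Nullary using (Dec; yes; no; contradiction)
open import Relation.Binary.PropositionalEquality

round-up : ∀ m n .{{_ : NonZero n}} → ∃ λ s → ∃ λ t → t < n × m + t ≡ s * n
round-up m n with m % n | m%n<n m n | m≡m%n+[m/n]*n m n
... | zero  | _   | m≡ = m / n , 0 , >-nonZero⁻¹ n , trans (+-identityʳ m) m≡
... | suc r | r<n | m≡ = suc (m / n) , n ∸ suc r , ∸-monoʳ-< (s≤s z≤n) (<⇒≤ r<n) , (begin
  m + (n ∸ suc r)                    ≡⟨ cong (_+ (n ∸ suc r)) m≡ ⟩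
  suc r + m / n * n + (n ∸ suc r)    ≡⟨ cong (_+ (n ∸ suc r)) (+-comm (suc r) (m / n * n)) ⟩
  m / n * n + suc r + (n ∸ suc r)    ≡⟨ +-assoc (m / n * n) (suc r) (n ∸ suc r) ⟩
  m / n * n + (suc r + (n ∸ suc r))  ≡⟨ cong (m / n * n +_) (m+[n∸m]≡n (<⇒≤ r<n)) ⟩
  m / n * n + n                      ≡⟨ +-comm (m / n * n) n ⟩
  suc (m / n) * n                    ∎)
  where open ≡-Reasoning

same-parity⇒even-gap : ∀ {s c A B} → s + 2 * A ≡ c + 2 * B → c ≤ suc s → ∃ λ x → s ≡ 2 * x + c
same-parity⇒even-gap {s} {c} {A} {B} eq c≤1+s with m≤n⇒m<n∨m≡n c≤1+s
... | inj₂ refl = contradiction (∣1⇒≡1 (∣m+n∣m⇒∣n 2∣2B+1 (m∣m*n B))) λ ()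
  where
  2∣2B+1 : 2 ∣ 2 * B + 1
  2∣2B+1 = divides A (begin
    2 * B + 1  ≡⟨ +-comm (2 * B) 1 ⟩
    1 + 2 * B  ≡⟨ +-cancelˡ-≡ s _ _ (trans eq (sym (+-suc s (2 * B)))) ⟨
    2 * A      ≡⟨ *-comm 2 A ⟩
    A * 2      ∎)
    where open ≡-Reasoning
... | inj₁ c<1+s with m≤n⇒∃[o]m+o≡n (≤-pred c<1+s)
... | d , refl with ∣m+n∣m⇒∣n 2∣2A+d (m∣m*n A)
  where
  2∣2A+d : 2 ∣ 2 * A + d
  2∣2A+d = divides B (begin
    2 * A + d      ≡⟨ +-comm (2 * A) d ⟩
    d + 2 * A      ≡⟨ +-cancelˡ-≡ c _ _ (trans (sym (+-assoc c d (2 * A))) eq) ⟩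
    2 * B          ≡⟨ *-comm 2 B ⟩
    B * 2          ∎)
    where open ≡-Reasoning
... | divides x refl = x , trans (+-comm c (x * 2)) (cong (_+ c) (*-comm x 2))

half-odd : ∀ k → half (1 + 2 * k) ≡ k
half-odd k = trans (cong (_/ 2) (*-comm 2 k)) (m*n/n≡m k 2)

odd-* : ∀ a b → (1 + 2 * a) * (1 + 2 * b) ≡ 1 + 2 * (2 * a * b + a + b)
odd-* = solve-∀

odd-combination : ∀ {p q p′ q′} → p ≡ 1 + 2 * p′ → q ≡ 1 + 2 * q′ →
                  ∀ y z w → y * q + z * p + w ≡ y + z + w + 2 * (y * q′ + z * p′)
odd-combination {p′ = p′} {q′} refl refl y z w = solve (y ∷ z ∷ w ∷ p′ ∷ q′ ∷ [])

odd-multiple : ∀ {p q p′ q′} → p ≡ 1 + 2 * p′ → q ≡ 1 + 2 * q′ →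
               ∀ s → s * (p * q) ≡ s + 2 * (s * (2 * p′ * q′ + p′ + q′))
odd-multiple {p′ = p′} {q′} refl refl s = solve (s ∷ p′ ∷ q′ ∷ [])

odd-prime : ∀ {p} → Prime p → 2 < p → ∃ λ p′ → p ≡ 1 + 2 * p′
odd-prime {p} p-prime 2<p with p % 2 | m%n<n p 2 | m≡m%n+[m/n]*n p 2
... | 0           | _            | p≡ =
  contradiction (composite 2<p (divides (p / 2) p≡)) (prime⇒¬composite p-prime)
... | 1           | _            | p≡ = p / 2 , trans p≡ (cong suc (*-comm (p / 2) 2))
... | suc (suc _) | s≤s (s≤s ()) | _

DoublyRepresentable : ℕ → ℕ → ℕ → Set
DoublyRepresentable p q n = Σ ℕ λ x → Σ ℕ λ y → Σ ℕ λ z → Σ ℕ λ w →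
  2 * n + (y * q + z * p + w) ≡ (2 * x + (y + z + w)) * (p * q)

rounding⇒doubly-representable : ∀ {p q p′ q′ n s t y z w} → p ≡ 1 + 2 * p′ → q ≡ 1 + 2 * q′ →
  2 * n + t ≡ s * (p * q) → y * q + z * p + w ≡ t → y + z + w ≤ suc s → DoublyRepresentable p q n
rounding⇒doubly-representable {p} {q} {p′} {q′} {n} {s} {t} {y} {z} {w} p≡ q≡ rounded sums c≤1+s =
  witness (same-parity⇒even-gap {A = s * (2 * p′ * q′ + p′ + q′)} {B = n + (y * q′ + z * p′)} parity c≤1+s)
  where
  open ≡-Reasoning
  parity : s + 2 * (s * (2 * p′ * q′ + p′ + q′)) ≡ y + z + w + 2 * (n + (y * q′ + z * p′))
  parity = begin
    s + 2 * (s * (2 * p′ * q′ + p′ + q′))        ≡⟨ odd-multiple {p′ = p′} {q′} p≡ q≡ s ⟨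
    s * (p * q)                                  ≡⟨ rounded ⟨
    2 * n + t                                    ≡⟨ cong (2 * n +_) sums ⟨
    2 * n + (y * q + z * p + w)                  ≡⟨ cong (2 * n +_) (odd-combination {p′ = p′} {q′} p≡ q≡ y z w) ⟩
    2 * n + (y + z + w + 2 * (y * q′ + z * p′))  ≡⟨ solve (n ∷ y ∷ z ∷ w ∷ q′ ∷ p′ ∷ []) ⟩
    y + z + w + 2 * (n + (y * q′ + z * p′))      ∎
  witness : (∃ λ x → s ≡ 2 * x + (y + z + w)) → DoublyRepresentable p q n
  witness (x , s≡) = x , y , z , w , (begin
    2 * n + (y * q + z * p + w)      ≡⟨ cong (2 * n +_) sums ⟩
    2 * n + t                        ≡⟨ rounded ⟩
    s * (p * q)                      ≡⟨ cong (_* (p * q)) s≡ ⟩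
    (2 * x + (y + z + w)) * (p * q)  ∎)

fℕ : ℕ → ℕ → ℕ → ℕ → ℕ → ℕ → ℕ
fℕ p q x y z w = x * d₀ p q + y * d₁ p q + z * d₂ p q + w * d₃ p q

f-cast : ∀ p q x y z w → f p q (ℤ.+ x) (ℤ.+ y) (ℤ.+ z) (ℤ.+ w) ≡ ℤ.+ fℕ p q x y z w
f-cast p q x y z w = sym
  (trans (ℤ.pos-+ (X + Y + Z) W) (cong₂ ℤ._+_
    (trans (ℤ.pos-+ (X + Y) Z) (cong₂ ℤ._+_
      (trans (ℤ.pos-+ X Y) (cong₂ ℤ._+_ (ℤ.pos-* x (d₀ p q)) (ℤ.pos-* y (d₁ p q))))
      (ℤ.pos-* z (d₂ p q))))
    (ℤ.pos-* w (d₃ p q))))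
  where
  X = x * d₀ p q
  Y = y * d₁ p q
  Z = z * d₂ p q
  W = w * d₃ p q

fℕ-halves : ∀ {p q p′ q′ D} → half p ≡ p′ → half q ≡ q′ → half (p * q) ≡ D →
            ∀ x y z w → fℕ p q x y z w ≡ x * (p * q) + y * (p′ * q) + z * (p * q′) + w * D
fℕ-halves refl refl refl x y z w = refl

fℕ-odd : ∀ {p q p′ q′} → p ≡ 1 + 2 * p′ → q ≡ 1 + 2 * q′ →
         ∀ x y z w →
         fℕ p q x y z w ≡ x * (p * q) + y * (p′ * q) + z * (p * q′) + w * (2 * p′ * q′ + p′ + q′)
fℕ-odd {p′ = p′} {q′} refl refl = fℕ-halves {1 + 2 * p′} {1 + 2 * q′} (half-odd p′) (half-odd q′)
  (trans (cong half (odd-* p′ q′)) (half-odd (2 * p′ * q′ + p′ + q′)))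


doubling : ∀ {p q p′ q′} → p ≡ 1 + 2 * p′ → q ≡ 1 + 2 * q′ →
           ∀ x y z w → 2 * fℕ p q x y z w + (y * q + z * p + w) ≡ (2 * x + (y + z + w)) * (p * q)
doubling {p′ = p′} {q′} p≡ q≡ x y z w rewrite fℕ-odd {p′ = p′} {q′} p≡ q≡ x y z w | p≡ | q≡ =
  solve (x ∷ y ∷ z ∷ w ∷ p′ ∷ q′ ∷ [])

doubly⇒representable : ∀ {p q p′ q′ n} → p ≡ 1 + 2 * p′ → q ≡ 1 + 2 * q′ →
                       DoublyRepresentable p q n → Representable p q (ℤ.+ n)
doubly⇒representable {p} {q} {p′} {q′} {n} p≡ q≡ (x , y , z , w , doubled) =
  x , y , z , w , trans (cong ℤ.+_ n≡fℕ) (sym (f-cast p q x y z w))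
  where
  n≡fℕ : n ≡ fℕ p q x y z w
  n≡fℕ = *-cancelˡ-≡ n (fℕ p q x y z w) 2 (+-cancelʳ-≡ (y * q + z * p + w) _ _
    (trans doubled (sym (doubling {p′ = p′} {q′} p≡ q≡ x y z w))))

g₁⁺ g₁⁻ : ℕ → ℕ → ℕ → ℕ → ℕ
g₁⁺ p q κ l = fℕ p q (half p) p κ 0
g₁⁻ p q κ l = fℕ p q 1 1 0 (suc l)

g₁-split : ∀ p q κ l → g₁ p q κ l ℤ.+ ℤ.+ g₁⁻ p q κ l ≡ ℤ.+ g₁⁺ p q κ l
g₁-split p q κ l = begin
  g₁ p q κ l ℤ.+ ℤ.+ g₁⁻ p q κ l  ≡⟨ cong (λ i → g₁ p q κ l ℤ.+ i) (f-cast p q 1 1 0 (suc l)) ⟨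
  g₁ p q κ l ℤ.+ f p q (ℤ.+ 1) (ℤ.+ 1) (ℤ.+ 0) (ℤ.+ suc l)
    ≡⟨ linearity (ℤ.+ half p) (ℤ.+ p) (ℤ.+ κ) (ℤ.+ l)
                 (ℤ.+ d₀ p q) (ℤ.+ d₁ p q) (ℤ.+ d₂ p q) (ℤ.+ d₃ p q) ⟩
  f p q (ℤ.+ half p) (ℤ.+ p) (ℤ.+ κ) (ℤ.+ 0)  ≡⟨ f-cast p q (half p) p κ 0 ⟩
  ℤ.+ g₁⁺ p q κ l  ∎
  where
  open ≡-Reasoning
  linearity : ∀ H P K L a b c d →
    (H ℤ.- ℤ.+ 1) ℤ.* a ℤ.+ (P ℤ.- ℤ.+ 1) ℤ.* b ℤ.+ K ℤ.* c ℤ.+ (ℤ.- ℤ.+ 1) ℤ.* d ℤ.- L ℤ.* d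
      ℤ.+ (ℤ.+ 1 ℤ.* a ℤ.+ ℤ.+ 1 ℤ.* b ℤ.+ ℤ.+ 0 ℤ.* c ℤ.+ (ℤ.+ 1 ℤ.+ L) ℤ.* d)
    ≡ H ℤ.* a ℤ.+ P ℤ.* b ℤ.+ K ℤ.* c ℤ.+ ℤ.+ 0 ℤ.* d
  linearity = ℤ-Solver.solve-∀

doubled-g₁ : ∀ {p q p′ q′} → p ≡ 1 + 2 * p′ → q ≡ 1 + 2 * q′ → ∀ κ l →
  2 * g₁⁺ p q κ l + ((6 + l) * (p * q) + κ * p) ≡ (p + p + κ) * (p * q) + q + l + 1 + 2 * g₁⁻ p q κ l
doubled-g₁ {p} {q} {p′} {q′} p≡ q≡ κ l
  rewrite fℕ-odd {p′ = p′} {q′} p≡ q≡ (half p) p κ 0 | fℕ-odd {p′ = p′} {q′} p≡ q≡ 1 1 0 (suc l)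
        | p≡ | q≡ | half-odd p′ =
  solve (p′ ∷ q′ ∷ κ ∷ l ∷ [])

>-difference : ∀ {i a b} n → i ℤ.+ ℤ.+ b ≡ ℤ.+ a → b ≤ a → i ℤ.< n →
               ∃ λ m → n ≡ ℤ.+ m × a < m + b
>-difference {b = b} (ℤ.+ m) i+b≡a b≤a i<n =
  m , refl , ℤ.drop‿+<+ (subst (ℤ._< ℤ.+ (m + b)) i+b≡a (ℤ.+-monoˡ-< (ℤ.+ b) i<n))
>-difference {b = b} -[1+ k ] i+b≡a b≤a i<n = contradiction
  (ℤ.drop‿+<+ (ℤ.<-≤-trans (subst (ℤ._< b ℤ.⊖ suc k) i+b≡a (ℤ.+-monoˡ-< (ℤ.+ b) i<n))
                            (ℤ.m⊖n≤m b (suc k))))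
  (≤⇒≯ b≤a)

module _ {p κ l : ℕ} (1≤κ : 1 ≤ κ) (1≤l : 1 ≤ l) (κ+2l≤p : κ + (l + l) ≤ p) where

  open ≤-Reasoning

  q : ℕ
  q = κ * p + l

  record Cheap (t : ℕ) (Room : Set) : Set where
    constructor cheap
    field
      y z w : ℕ
      sums : y * q + z * p + w ≡ t
      weak : y + z + w + 3 + l ≤ p + p + κ
      strong : Room → y + z + w + 4 + l ≤ p + p + κ

  private
    within-budget : ∀ {c} U A B → c ≡ U + (A + B) → U ≤ p → A ≤ κ → B ≤ p → c ≤ p + p + κ
    within-budget {c} U A B c≡ U≤p A≤κ B≤p = begin
      c             ≡⟨ c≡ ⟩
      U + (A + B)   ≤⟨ +-mono-≤ U≤p (+-mono-≤ A≤κ B≤p) ⟩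
      p + (κ + p)   ≡⟨ solve (p ∷ κ ∷ []) ⟩
      p + p + κ     ∎

    l≤p : l ≤ p
    l≤p = ≤-trans (m≤n+m l (κ + l)) (≤-trans (≤-reflexive (+-assoc κ l l)) κ+2l≤p)

    2l<p : suc (l + l) ≤ p
    2l<p = ≤-trans (+-monoˡ-≤ (l + l) 1≤κ) κ+2l≤p

    l+2≤p : 2 + l ≤ p
    l+2≤p = ≤-trans (s≤s (+-monoˡ-≤ l 1≤l)) 2l<p

  leading-digit-≤ : ∀ {a b} → a * p + b < q → a ≤ κ
  leading-digit-≤ {a} {b} v<q = <⇒≤pred (*-cancelʳ-< p a (suc κ) (begin-strict
    a * p          ≤⟨ m≤m+n (a * p) b ⟩
    a * p + b      <⟨ v<q ⟩
    κ * p + l      ≤⟨ +-monoʳ-≤ (κ * p) l≤p ⟩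
    κ * p + p      ≡⟨ +-comm (κ * p) p ⟩
    suc κ * p      ∎))

  leading-digit-< : ∀ {a b} → l ≤ b → a * p + b < q → a < κ
  leading-digit-< {a} {b} l≤b v<q =
    *-cancelʳ-< p a κ (+-cancelʳ-< b (a * p) (κ * p) (<-≤-trans v<q (+-monoʳ-≤ (κ * p) l≤b)))

  LowRemainder : ℕ → ℕ → Set
  LowRemainder a b = a * p + (2 + b + l) ≤ κ * p

  low-remainder⇒leading-digit-< : ∀ {a b} → LowRemainder a b → a < κ
  low-remainder⇒leading-digit-< {a} low = *-cancelʳ-< p a κ (<-≤-trans (m<m+n (a * p) (s≤s z≤n)) low)

  low-remainder⇒suc-leading-digit-< : ∀ {a b} → p ≤ b + l → LowRemainder a b → suc a < κ
  low-remainder⇒suc-leading-digit-< {a} {b} p≤b+l low = *-cancelʳ-< p (suc a) κ (begin-strict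
    p + a * p            ≤⟨ +-monoˡ-≤ (a * p) p≤b+l ⟩
    b + l + a * p        ≡⟨ +-comm (b + l) (a * p) ⟩
    a * p + (b + l)      <⟨ +-monoʳ-< (a * p) (m<n+m (b + l) {2} (s≤s z≤n)) ⟩
    a * p + (2 + b + l)  ≤⟨ low ⟩
    κ * p                ∎)

  low-remainder⇒last-digit : ∀ {a b} → κ ≡ suc a → LowRemainder a b → 2 + b + l ≤ p
  low-remainder⇒last-digit {a} refl low = +-cancelˡ-≤ (a * p) _ _ (≤-trans low (≤-reflexive (+-comm p (a * p))))

  -- What t + 2λ + 2 ≤ pq says about the digits of t = uq + ap + b.
  Slack : ℕ → ℕ → ℕ → Set
  Slack u a b = 2 + u ≤ p ⊎ LowRemainder a b

  small-last-digit : ∀ {u a b} → b < l → u < p → a * p + b < q →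
                     Cheap (u * q + a * p + b) (Slack u a b)
  small-last-digit {u} {a} {b} b<l u<p v<q = cheap u a b refl
    (within-budget (suc u) a (suc b + suc l) (solve (u ∷ a ∷ b ∷ l ∷ [])) u<p (leading-digit-≤ v<q) B≤p)
    λ where
      (inj₁ 2+u≤p) → within-budget (2 + u) a (suc b + suc l) (solve (u ∷ a ∷ b ∷ l ∷ []))
                       2+u≤p (leading-digit-≤ v<q) B≤p
      (inj₂ low) → within-budget (suc u) (suc a) (suc b + suc l) (solve (u ∷ a ∷ b ∷ l ∷ []))
                     u<p (low-remainder⇒leading-digit-< low) B≤p
    where
    B≤p : suc b + suc l ≤ p
    B≤p = ≤-trans (+-monoˡ-≤ (suc l) b<l) (≤-trans (≤-reflexive (+-suc l l)) 2l<p)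

  medium-last-digit : ∀ {u a b} → l ≤ b → b + l < p → u < p → a * p + b < q →
                      Cheap (u * q + a * p + b) (Slack u a b)
  medium-last-digit {u} {a} {b} l≤b b+l<p u<p v<q = cheap u a b refl
    (within-budget (suc u) (suc a) (suc (b + l)) (solve (u ∷ a ∷ b ∷ l ∷ [])) u<p a<κ b+l<p)
    λ where
      (inj₁ 2+u≤p) → within-budget (2 + u) (suc a) (suc (b + l)) (solve (u ∷ a ∷ b ∷ l ∷ []))
                       2+u≤p a<κ b+l<p
      (inj₂ low) → low-remainder-case low (m≤n⇒m<n∨m≡n a<κ)
    where
    a<κ : a < κ
    a<κ = leading-digit-< l≤b v<q
    low-remainder-case : LowRemainder a b → suc a < κ ⊎ suc a ≡ κ → u + a + b + 4 + l ≤ p + p + κ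
    low-remainder-case _ (inj₁ a+1<κ) =
      within-budget (suc u) (2 + a) (suc (b + l)) (solve (u ∷ a ∷ b ∷ l ∷ [])) u<p a+1<κ b+l<p
    low-remainder-case low (inj₂ a+1≡κ) =
      within-budget (suc u) (suc a) (2 + b + l) (solve (u ∷ a ∷ b ∷ l ∷ []))
        u<p a<κ (low-remainder⇒last-digit (sym a+1≡κ) low)

  zero-quotient : ∀ {a b} → l ≤ b → b < p → a * p + b < q → Cheap (0 * q + a * p + b) (Slack 0 a b)
  zero-quotient {a} {b} l≤b b<p v<q = cheap 0 a b refl
    (≤-trans (+-monoˡ-≤ l (+-monoʳ-≤ (a + b) (n≤1+n 3))) within) (λ _ → within)
    where
    within : a + b + 4 + l ≤ p + p + κ
    within = within-budget (suc b) (suc a) (2 + l) (solve (a ∷ b ∷ l ∷ [])) b<p (leading-digit-< l≤b v<q) l+2≤p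

  -- A last digit b ≥ p − λ borrows one q: q + ap + b = (a + κ + 1)p + o with o < λ.
  carry : ∀ {u a b} → l ≤ b → p ≤ b + l → suc u < p → b < p → a * p + b < q →
          Cheap (suc u * q + a * p + b) (Slack (suc u) a b)
  carry {u} {a} {b} l≤b p≤b+l u<p b<p v<q with m≤n⇒∃[o]m+o≡n p≤b+l
  ... | o , p+o≡b+l = cheap u (suc (a + κ)) o sums
    (within-budget (2 + u) (suc a) (suc o + (κ + l)) (solve (u ∷ a ∷ κ ∷ o ∷ l ∷ [])) u<p a<κ C≤p)
    λ where
      (inj₁ 3+u≤p) → within-budget (3 + u) (suc a) (suc o + (κ + l)) (solve (u ∷ a ∷ κ ∷ o ∷ l ∷ []))
                       3+u≤p a<κ C≤p
      (inj₂ low) → within-budget (2 + u) (2 + a) (suc o + (κ + l)) (solve (u ∷ a ∷ κ ∷ o ∷ l ∷ []))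
                     u<p (low-remainder⇒suc-leading-digit-< p≤b+l low) C≤p
    where
    a<κ : a < κ
    a<κ = leading-digit-< l≤b v<q
    o<l : o < l
    o<l = +-cancelˡ-< p o l (begin-strict
      p + o  ≡⟨ p+o≡b+l ⟩
      b + l  <⟨ +-monoˡ-< l b<p ⟩
      p + l  ∎)
    C≤p : suc o + (κ + l) ≤ p
    C≤p = begin
      suc o + (κ + l)  ≤⟨ +-monoˡ-≤ (κ + l) o<l ⟩
      l + (κ + l)      ≡⟨ solve (l ∷ κ ∷ []) ⟩
      κ + (l + l)      ≤⟨ κ+2l≤p ⟩
      p                ∎
    sums : u * q + suc (a + κ) * p + o ≡ suc u * q + a * p + b
    sums = begin-equality
      u * (κ * p + l) + suc (a + κ) * p + o ≡⟨ solve (u ∷ κ ∷ p ∷ l ∷ a ∷ o ∷ []) ⟩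
      u * (κ * p + l) + (a + κ) * p + (p + o) ≡⟨ cong (u * (κ * p + l) + (a + κ) * p +_) p+o≡b+l ⟩
      u * (κ * p + l) + (a + κ) * p + (b + l) ≡⟨ solve (u ∷ κ ∷ p ∷ l ∷ a ∷ b ∷ []) ⟩
      suc u * (κ * p + l) + a * p + b        ∎

  digits-cheap : ∀ {u a b} → u < p → b < p → a * p + b < q → Cheap (u * q + a * p + b) (Slack u a b)
  digits-cheap {u} {a} {b} u<p b<p v<q with l ≤? b | b + l <? p | u
  ... | no l≰b  | _         | u′     = small-last-digit {u′} {a} (≰⇒> l≰b) u<p v<q
  ... | yes l≤b | yes b+l<p | u′     = medium-last-digit {u′} {a} l≤b b+l<p u<p v<q
  ... | yes l≤b | no _      | zero   = zero-quotient {a} l≤b b<p v<q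
  ... | yes l≤b | no b+l≮p | suc u′ = carry {u′} {a} l≤b (≮⇒≥ b+l≮p) u<p b<p v<q

  relabel : ∀ {t t′} {S S′ : Set} → t ≡ t′ → (S′ → S) → Cheap t S → Cheap t′ S′
  relabel refl S′⇒S (cheap y z w sums weak strong) = cheap y z w sums weak (strong ∘ S′⇒S)

  private instance
    p-nonZero : NonZero p
    p-nonZero = >-nonZero (≤-trans 1≤l l≤p)
    q-nonZero : NonZero q
    q-nonZero = >-nonZero (≤-trans 1≤l (m≤n+m l (κ * p)))
    pq-nonZero : NonZero (p * q)
    pq-nonZero = m*n≢0 p q

  greedy-cheap : ∀ t → t < p * q → Cheap t (t + (l + l) + 2 ≤ p * q)
  greedy-cheap t t<pq = relabel digits≡t room⇒slack (digits-cheap {u} {a} u<p (m%n<n v p) v<q)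
    where
    u = t / q
    v = t % q
    a = v / p
    b = v % p
    v<q : a * p + b < q
    v<q = subst (_< q) (trans (m≡m%n+[m/n]*n v p) (+-comm b (a * p))) (m%n<n t q)
    u<p : u < p
    u<p = *-cancelʳ-< q u p (begin-strict
      u * q      ≤⟨ m≤n+m (u * q) v ⟩
      v + u * q  ≡⟨ m≡m%n+[m/n]*n t q ⟨
      t          <⟨ t<pq ⟩
      p * q      ∎)
    digits≡t : u * q + a * p + b ≡ t
    digits≡t = begin-equality
      u * q + a * p + b    ≡⟨ +-assoc (u * q) (a * p) b ⟩
      u * q + (a * p + b)  ≡⟨ +-comm (u * q) (a * p + b) ⟩
      a * p + b + u * q    ≡⟨ cong (_+ u * q) (trans (m≡m%n+[m/n]*n v p) (+-comm b (a * p))) ⟨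
      v + u * q            ≡⟨ m≡m%n+[m/n]*n t q ⟨
      t                    ∎
    shuffle : ∀ A B L U → A + (2 + B + L) + (L + U) ≡ U + A + B + (L + L) + 2
    shuffle = solve-∀
    room⇒slack : t + (l + l) + 2 ≤ p * q → Slack u a b
    room⇒slack room with m≤n⇒m<n∨m≡n u<p
    ... | inj₁ u+1<p = inj₁ u+1<p
    ... | inj₂ u+1≡p = inj₂ (+-cancelʳ-≤ (l + u * q) (a * p + (2 + b + l)) (κ * p) (begin
      a * p + (2 + b + l) + (l + u * q)  ≡⟨ shuffle (a * p) b l (u * q) ⟩
      u * q + a * p + b + (l + l) + 2    ≡⟨ cong (λ s → s + (l + l) + 2) digits≡t ⟩
      t + (l + l) + 2                    ≤⟨ room ⟩
      p * q                              ≡⟨ cong (_* q) u+1≡p ⟨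
      q + u * q                          ≡⟨ +-assoc (κ * p) l (u * q) ⟩
      κ * p + (l + u * q)                ∎))

  N : ℕ
  N = p * q

  rounding-affords-cost : ∀ {n s t c} →
    (p + p + κ) * N + (l + l) + 3 ≤ 2 * n + (6 + l) * N → 2 * n + t ≡ s * N →
    c + 3 + l ≤ p + p + κ → (t + (l + l) + 2 ≤ N → c + 4 + l ≤ p + p + κ) → c ≤ suc s
  rounding-affords-cost {n} {s} {t} {c} above rounded weak strong = by-room (t + (l + l) + 2 ≤? N)
    where
    headroom : (p + p + κ) * N + suc (t + (l + l) + 2) ≤ (s + (6 + l)) * N
    headroom = begin
      (p + p + κ) * N + suc (t + (l + l) + 2)  ≡⟨ shuffle ((p + p + κ) * N) t l ⟩
      (p + p + κ) * N + (l + l) + 3 + t        ≤⟨ +-monoˡ-≤ t above ⟩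
      2 * n + (6 + l) * N + t                  ≡⟨ swap (2 * n) ((6 + l) * N) t ⟩
      2 * n + t + (6 + l) * N                  ≡⟨ cong (_+ (6 + l) * N) rounded ⟩
      s * N + (6 + l) * N                      ≡⟨ *-distribʳ-+ N s (6 + l) ⟨
      (s + (6 + l)) * N                        ∎
      where
      shuffle : ∀ X t l → X + suc (t + (l + l) + 2) ≡ X + (l + l) + 3 + t
      shuffle = solve-∀
      swap : ∀ a b c → a + b + c ≡ a + c + b
      swap = solve-∀
    affordable : ∀ {B} → c + 4 + l ≤ B → B < s + (6 + l) → c ≤ suc s
    affordable {B} c+4+l≤B B<s+6+l = +-cancelʳ-≤ (5 + l) c (suc s) (begin
      c + (5 + l)     ≡⟨ solve (c ∷ l ∷ []) ⟩
      suc (c + 4 + l) ≤⟨ s≤s c+4+l≤B ⟩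
      suc B           ≤⟨ B<s+6+l ⟩
      s + (6 + l)     ≡⟨ +-suc s (5 + l) ⟩
      suc s + (5 + l) ∎)
    by-room : Dec (t + (l + l) + 2 ≤ N) → c ≤ suc s
    by-room (yes room) = affordable (strong room) (*-cancelʳ-< N (p + p + κ) (s + (6 + l))
      (<-≤-trans (m<m+n ((p + p + κ) * N) (s≤s z≤n)) headroom))
    by-room (no no-room) = affordable (≤-trans (≤-reflexive (cong (_+ l) (+-suc c 3))) (s≤s weak))
      (*-cancelʳ-< N (suc (p + p + κ)) (s + (6 + l)) (begin-strict
      N + (p + p + κ) * N                      <⟨ +-monoˡ-< ((p + p + κ) * N) (m<n⇒m<1+n (≰⇒> no-room)) ⟩
      suc (t + (l + l) + 2) + (p + p + κ) * N  ≡⟨ +-comm _ ((p + p + κ) * N) ⟩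
      (p + p + κ) * N + suc (t + (l + l) + 2)  ≤⟨ headroom ⟩
      (s + (6 + l)) * N                        ∎))

  doubly-representable : ∀ {p′ q′} → p ≡ 1 + 2 * p′ → q ≡ 1 + 2 * q′ → ∀ n →
    (p + p + κ) * N + (l + l) + 3 ≤ 2 * n + (6 + l) * N → DoublyRepresentable p q n
  doubly-representable {p′} {q′} p≡ q≡ n above =
    let s , t , t<N , rounded = round-up (2 * n) N
        cheap y z w sums weak strong = greedy-cheap t t<N
    in rounding⇒doubly-representable {p′ = p′} {q′} {n} {y = y} {z} {w} p≡ q≡ rounded sums
         (rounding-affords-cost {n} {s} {t} above rounded weak strong)

  6+l≤budget : 6 + l ≤ p + p + κ
  6+l≤budget = begin
    6 + l                            ≡⟨ solve (l ∷ []) ⟩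
    3 + (1 + 1 + 1 + l)              ≤⟨ +-monoʳ-≤ 3 (+-monoˡ-≤ l (+-mono-≤ (+-mono-≤ 1≤l 1≤l) 1≤l)) ⟩
    3 + (l + l + l + l)              ≡⟨ solve (l ∷ []) ⟩
    suc (l + l) + suc (l + l) + 1    ≤⟨ +-mono-≤ (+-mono-≤ 2l<p 2l<p) 1≤κ ⟩
    p + p + κ                        ∎

  private
    B G⁺ G⁻ : ℕ
    B = (p + p + κ) * N
    G⁺ = g₁⁺ p q κ l
    G⁻ = g₁⁻ p q κ l

  g₁⁻≤g₁⁺ : ∀ {p′ q′} → p ≡ 1 + 2 * p′ → q ≡ 1 + 2 * q′ → g₁⁻ p q κ l ≤ g₁⁺ p q κ l
  g₁⁻≤g₁⁺ {p′} {q′} p≡ q≡ = *-cancelˡ-≤ 2 (+-cancelʳ-≤ ((6 + l) * N + κ * p) _ _ (begin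
    2 * G⁻ + ((6 + l) * N + κ * p)  ≤⟨ +-monoʳ-≤ (2 * G⁻) C≤X ⟩
    2 * G⁻ + (B + q + l + 1)        ≡⟨ +-comm (2 * G⁻) _ ⟩
    B + q + l + 1 + 2 * G⁻          ≡⟨ doubled-g₁ {p′ = p′} {q′} p≡ q≡ κ l ⟨
    2 * G⁺ + ((6 + l) * N + κ * p)  ∎))
    where
    C≤X : (6 + l) * N + κ * p ≤ B + q + l + 1
    C≤X = ≤-trans (+-mono-≤ (*-monoˡ-≤ N 6+l≤budget) (m≤m+n (κ * p) l))
                  (≤-trans (m≤m+n _ l) (m≤m+n _ 1))

  above-g₁ : ∀ {p′ q′ n} → p ≡ 1 + 2 * p′ → q ≡ 1 + 2 * q′ → g₁ p q κ l ℤ.< n →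
             ∃ λ m → n ≡ ℤ.+ m × (p + p + κ) * N + (l + l) + 3 ≤ 2 * m + (6 + l) * N
  above-g₁ {p′} {q′} {n} p≡ q≡ g₁<n =
    let m , n≡m , g₁⁺<m+g₁⁻ = >-difference n (g₁-split p q κ l) (g₁⁻≤g₁⁺ {p′} {q′} p≡ q≡) g₁<n
    in m , n≡m , +-cancelʳ-≤ (κ * p + 2 * G⁻) _ _ (begin
      B + (l + l) + 3 + (κ * p + 2 * G⁻)      ≡⟨ e₁ B (κ * p) l G⁻ ⟩
      B + q + l + 1 + 2 * G⁻ + 2              ≡⟨ cong (_+ 2) (doubled-g₁ {p′ = p′} {q′} p≡ q≡ κ l) ⟨
      2 * G⁺ + ((6 + l) * N + κ * p) + 2      ≡⟨ e₂ G⁺ ((6 + l) * N + κ * p) ⟩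
      2 * suc G⁺ + ((6 + l) * N + κ * p)      ≤⟨ +-monoˡ-≤ _ (*-monoʳ-≤ 2 g₁⁺<m+g₁⁻) ⟩
      2 * (m + G⁻) + ((6 + l) * N + κ * p)    ≡⟨ e₃ m G⁻ ((6 + l) * N) (κ * p) ⟩
      2 * m + (6 + l) * N + (κ * p + 2 * G⁻)  ∎)
    where
    e₁ : ∀ X K L G → X + (L + L) + 3 + (K + 2 * G) ≡ X + (K + L) + L + 1 + 2 * G + 2
    e₁ = solve-∀
    e₂ : ∀ G C → 2 * G + C + 2 ≡ 2 * suc G + C
    e₂ = solve-∀
    e₃ : ∀ m G Y K → 2 * (m + G) + (Y + K) ≡ 2 * m + Y + (K + 2 * G)
    e₃ = solve-∀

  representable-above-g₁ : ∀ {p′ q′} → p ≡ 1 + 2 * p′ → q ≡ 1 + 2 * q′ →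
                           ∀ n → g₁ p q κ l ℤ.< n → Representable p q n
  representable-above-g₁ {p′} {q′} p≡ q≡ n g₁<n =
    let m , n≡m , above = above-g₁ {p′} {q′} p≡ q≡ g₁<n
    in subst (Representable p q) (sym n≡m)
         (doubly⇒representable {p′ = p′} {q′} p≡ q≡ (doubly-representable {p′} {q′} p≡ q≡ m above))

positive-quotient : ∀ {p κ l} → p < κ * p + l → l ≤ p → 1 ≤ κ
positive-quotient {κ = zero}  p<l l≤p = contradiction l≤p (<⇒≱ p<l)
positive-quotient {κ = suc _} _   _   = s≤s z≤n

proposition6p1 : (p q κ λ′ : ℕ) → Prime p → Prime q → 2 < p → p < q →
                 q ≡ κ * p + λ′ → 1 ≤ λ′ → λ′ ≤ p ∸ 1 →
                 κ + λ′ ≤ p ∸ λ′ →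
                 (n : ℤ) → g₁ p q κ λ′ ℤ.< n → Representable p q n
proposition6p1 p .(κ * p + l) κ l p-prime q-prime 2<p p<q refl 1≤l l≤p∸1 κ+l≤p∸l n g₁<n =
  let p′ , p≡ = odd-prime p-prime 2<p
      q′ , q≡ = odd-prime q-prime (<-trans 2<p p<q)
  in representable-above-g₁ {p} {κ} {l} (positive-quotient p<q l≤p) 1≤l κ+2l≤p
                            {p′} {q′} p≡ q≡ n g₁<n
  where
  l≤p : l ≤ p
  l≤p = ≤-trans l≤p∸1 (m∸n≤m p 1)
  κ+2l≤p : κ + (l + l) ≤ p
  κ+2l≤p = begin
    κ + (l + l)  ≡⟨ +-assoc κ l l ⟨
    κ + l + l    ≤⟨ +-monoˡ-≤ l κ+l≤p∸l ⟩
    p ∸ l + l    ≡⟨ m∸n+n≡m l≤p ⟩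
    p            ∎
    where open ≤-Reasoning
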